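{- Let $d \geq 2$ and let $\mathcal{C}$ be a pure $d$-dimensional simplicial complex that is fully coned with respect to $H$, where $|H| \geq d-2$. Then for every $d$-clique (set of $d$ pairwise adjacent vertices) of $\mathrm{skel}(\mathcal{C})$ there is a facet of $\mathcal{C}$ containing it.
   Context: $\mathrm{skel}(\mathcal{C})$ is the graph whose vertices are the vertices of $\mathcal{C}$ and whose edges are the $2$-element faces of $\mathcal{C}$. For $d\ge2$, a pure $d$-dimensional complex $\mathcal{C}$ is fully coned with respect to a subset $H$ of its vertex set if (i) every $h\in H$ is adjacent in $\mathrm{skel}(\mathcal{C})$ to every other vertex, and (ii) every $(d+1)$-clique of $\mathrm{skel}(\mathcal{C})$ is a facet of $\mathcal{C}$. -}

module Defs where

open import Data.Nat using (ℕ; suc)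
open import Data.Fin using (Fin)
open import Data.Fin.Subset using (Subset; ⁅_⁆; _∪_; _∈_; _⊆_; ∣_∣)
open import Data.Product using (Σ; _×_; ∃)
open import Relation.Binary.PropositionalEquality using (_≡_; _≢_)
open import Relation.Unary using (Decidable)
open import Level using (0ℓ)

record SimplicialComplex (n : ℕ) : Set₁ where
  field
    Face       : Subset n → Set
    face?      : Decidable Face
    down-closed : ∀ {σ τ} → Face σ → τ ⊆ σ → Face τ
open SimplicialComplex public

module _ {n : ℕ} (C : SimplicialComplex n) where

  IsVertex : Fin n → Set
  IsVertex v = Face C ⁅ v ⁆

  IsFacet : Subset n → Set
  IsFacet σ = Face C σ × (∀ τ → Face C τ → σ ⊆ τ → τ ⊆ σ)

  PureDim : ℕ → Set
  PureDim d = ∀ σ → IsFacet σ → ∣ σ ∣ ≡ suc d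

  Adj : Fin n → Fin n → Set
  Adj u v = u ≢ v × Face C (⁅ u ⁆ ∪ ⁅ v ⁆)

  IsClique : Subset n → Set
  IsClique K = (∀ {v} → v ∈ K → IsVertex v)
             × (∀ {u v} → u ∈ K → v ∈ K → u ≢ v → Adj u v)

  IsKClique : ℕ → Subset n → Set
  IsKClique k K = IsClique K × ∣ K ∣ ≡ k

  FullyConed : ℕ → Subset n → Set
  FullyConed d H =
      (∀ {h} → h ∈ H → IsVertex h)
    × (∀ {h v} → h ∈ H → IsVertex v → v ≢ h → Adj h v)
    × (∀ K → IsKClique (suc d) K → IsFacet K)

{-# OPTIONS --safe #-}
-- If some cone vertex h lies outside the d-clique K, then K ∪ {h} is a
-- (d+1)-clique and hence a facet. Otherwise H ⊆ K, so at most two vertices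
-- of K lie outside H; they span a face of C, and any facet F through that
-- face has d + 1 > |K| vertices, hence a vertex w ∉ K. Such a w is adjacent
-- to K ∖ H through F and to K ∩ H by coning, so K ∪ {w} is a facet.
module Submission where

open import Defs
open import Data.Nat using (ℕ; zero; suc; _+_; _∸_; _≤_; _<_; z≤n; s≤s; s≤s⁻¹)
open import Data.Nat.Properties
  using (≤-trans; ≤-reflexive; ≤-<-trans; ≤⇒≯; <⇒≱; <⇒≢; +-suc; +-monoʳ-≤; +-cancelʳ-≤; m≤n+m∸n; m≤m+n; module ≤-Reasoning)
open import Data.Fin using (Fin)
import Data.Fin as Fin
open import Data.Fin.Properties using (_≟_; any?)
open import Data.Fin.Subset
  using (Subset; inside; outside; _∈_; _∉_; _⊆_; _∪_; _∩_; _─_; _-_; ⁅_⁆; ∣_∣; Nonempty; Empty)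
open import Data.Fin.Subset.Properties
  using (_∈?_; nonempty?; Empty-unique; ∣⊥∣≡0; ∣p∣≤n; p⊆q⇒∣p∣≤∣q∣; ⊆-refl; ⊆-trans; x∈⁅x⁆; x∈⁅y⁆⇒x≡y; x∉⁅y⁆⇒x≢y;
         p⊆p∪q; q⊆p∪q; x∈p∪q⁻; x∈p∪q⁺; x∈p∩q⁺; ∪-identityʳ; p─q⊆p; x∈p∧x∉q⇒x∈p─q;
         x∈p∧x≢y⇒x∈p-y; x∈p⇒∣p-x∣<∣p∣)
open import Data.Vec using (_∷_; []; here; there)
open import Data.Product using (Σ; ∃; ∃₂; _×_; _,_)
open import Data.Sum using (_⊎_; inj₁; inj₂; [_,_]′)
open import Function using (_∘_)
open import Relation.Nullary using (¬_; yes; no; contradiction)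
open import Relation.Nullary.Decidable using (decidable-stable; ¬?; _×-dec_)
open import Relation.Binary.PropositionalEquality using (_≡_; _≢_; refl; sym; trans; cong; subst; ≢-sym)

private variable
  n d k : ℕ
  p q r H K : Subset n
  x y : Fin n

x∈p⇒⁅x⁆⊆p : x ∈ p → ⁅ x ⁆ ⊆ p
x∈p⇒⁅x⁆⊆p {p = p} x∈p z∈⁅x⁆ = subst (_∈ p) (sym (x∈⁅y⁆⇒x≡y _ z∈⁅x⁆)) x∈p

∪-lub : p ⊆ r → q ⊆ r → p ∪ q ⊆ r
∪-lub {p = p} {q = q} p⊆r q⊆r z∈p∪q = [ p⊆r , q⊆r ]′ (x∈p∪q⁻ p q z∈p∪q)

x∈p─q⇒x∉q : ∀ (p q : Subset n) → x ∈ p ─ q → x ∉ q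
x∈p─q⇒x∉q (inside ∷ p) (outside ∷ q) here ()
x∈p─q⇒x∉q (_ ∷ p) (_ ∷ q) (there x∈p─q) (there x∈q) = x∈p─q⇒x∉q p q x∈p─q x∈q

⊆⊎∃∈∉ : ∀ (p q : Subset n) → p ⊆ q ⊎ ∃ λ x → x ∈ p × x ∉ q
⊆⊎∃∈∉ p q with any? (λ x → (x ∈? p) ×-dec ¬? (x ∈? q))
... | yes witness = inj₂ witness
... | no ¬witness = inj₁ λ {x} x∈p → decidable-stable (x ∈? q) (λ x∉q → ¬witness (x , x∈p , x∉q))

∣p∣<∣q∣⇒∃∈∉ : ∣ p ∣ < ∣ q ∣ → ∃ λ x → x ∈ q × x ∉ p
∣p∣<∣q∣⇒∃∈∉ {p = p} {q = q} ∣p∣<∣q∣ with ⊆⊎∃∈∉ q p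
... | inj₁ q⊆p = contradiction (p⊆q⇒∣p∣≤∣q∣ q⊆p) (<⇒≱ ∣p∣<∣q∣)
... | inj₂ witness = witness

∣p∣≤0⇒Empty : ∣ p ∣ ≤ 0 → Empty p
∣p∣≤0⇒Empty ∣p∣≤0 (x , x∈p) = ≤⇒≯ ∣p∣≤0 (≤-<-trans z≤n (x∈p⇒∣p-x∣<∣p∣ x∈p))

0<∣p∣⇒Nonempty : ∀ {n} {p : Subset n} → 0 < ∣ p ∣ → Nonempty p
0<∣p∣⇒Nonempty {n = n} {p = p} 0<∣p∣ = decidable-stable (nonempty? p) λ p-empty →
  <⇒≢ 0<∣p∣ (sym (trans (cong ∣_∣ (Empty-unique p-empty)) (∣⊥∣≡0 n)))

∣p∣≤1+k⇒∣p-x∣≤k : ∣ p ∣ ≤ suc k → x ∈ p → ∣ p - x ∣ ≤ k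
∣p∣≤1+k⇒∣p-x∣≤k ∣p∣≤1+k x∈p = s≤s⁻¹ (≤-trans (x∈p⇒∣p-x∣<∣p∣ x∈p) ∣p∣≤1+k)

Empty[p-x]⇒p⊆⁅x⁆ : Empty (p - x) → p ⊆ ⁅ x ⁆
Empty[p-x]⇒p⊆⁅x⁆ {x = x} p-x-empty {z} z∈p with z ≟ x
... | yes refl = x∈⁅x⁆ z
... | no z≢x = contradiction (z , x∈p∧x≢y⇒x∈p-y z∈p z≢x) p-x-empty

∣p∣≤1⇒p⊆⁅x⁆ : ∣ p ∣ ≤ 1 → x ∈ p → p ⊆ ⁅ x ⁆
∣p∣≤1⇒p⊆⁅x⁆ ∣p∣≤1 x∈p = Empty[p-x]⇒p⊆⁅x⁆ (∣p∣≤0⇒Empty (∣p∣≤1+k⇒∣p-x∣≤k ∣p∣≤1 x∈p))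

∣p∣≤2⇒p⊆⁅x⁆∪⁅y⁆ : ∣ p ∣ ≤ 2 → x ∈ p → y ∈ p → x ≢ y → p ⊆ ⁅ x ⁆ ∪ ⁅ y ⁆
∣p∣≤2⇒p⊆⁅x⁆∪⁅y⁆ {p = p} {x = x} {y = y} ∣p∣≤2 x∈p y∈p x≢y {z} z∈p with z ≟ x
... | yes refl = x∈p∪q⁺ (inj₁ (x∈⁅x⁆ z))
... | no z≢x = x∈p∪q⁺ (inj₂ (∣p∣≤1⇒p⊆⁅x⁆ ∣p-x∣≤1 y∈p-x (x∈p∧x≢y⇒x∈p-y z∈p z≢x)))
  where
  ∣p-x∣≤1 : ∣ p - x ∣ ≤ 1
  ∣p-x∣≤1 = ∣p∣≤1+k⇒∣p-x∣≤k ∣p∣≤2 x∈p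
  y∈p-x : y ∈ p - x
  y∈p-x = x∈p∧x≢y⇒x∈p-y y∈p (≢-sym x≢y)

∣p∣≤2⇒⊆pair : Nonempty q → p ⊆ q → ∣ p ∣ ≤ 2 → ∃₂ λ x y → x ∈ q × y ∈ q × p ⊆ ⁅ x ⁆ ∪ ⁅ y ⁆
∣p∣≤2⇒⊆pair {p = p} (x , x∈q) p⊆q ∣p∣≤2 with nonempty? p
... | no p-empty = x , x , x∈q , x∈q , λ z∈p → contradiction (_ , z∈p) p-empty
... | yes (u , u∈p) with nonempty? (p - u)
...   | no p-u-empty = u , u , p⊆q u∈p , p⊆q u∈p , p⊆p∪q _ ∘ Empty[p-x]⇒p⊆⁅x⁆ p-u-empty
...   | yes (v , v∈p-u) = u , v , p⊆q u∈p , p⊆q v∈p , ∣p∣≤2⇒p⊆⁅x⁆∪⁅y⁆ ∣p∣≤2 u∈p v∈p u≢v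
  where
  v∈p : v ∈ p
  v∈p = p─q⊆p p ⁅ u ⁆ v∈p-u
  u≢v : u ≢ v
  u≢v = ≢-sym (x∉⁅y⁆⇒x≢y (x∈p─q⇒x∉q p ⁅ u ⁆ v∈p-u))

x∉p⇒∣p∪⁅x⁆∣≡1+∣p∣ : ∀ (p : Subset n) → x ∉ p → ∣ p ∪ ⁅ x ⁆ ∣ ≡ suc ∣ p ∣
x∉p⇒∣p∪⁅x⁆∣≡1+∣p∣ {x = Fin.zero}  (inside ∷ p)  x∉p = contradiction here x∉p
x∉p⇒∣p∪⁅x⁆∣≡1+∣p∣ {x = Fin.zero}  (outside ∷ p) _   = cong (suc ∘ ∣_∣) (∪-identityʳ p)
x∉p⇒∣p∪⁅x⁆∣≡1+∣p∣ {x = Fin.suc x} (inside ∷ p)  x∉p = cong suc (x∉p⇒∣p∪⁅x⁆∣≡1+∣p∣ p (x∉p ∘ there))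
x∉p⇒∣p∪⁅x⁆∣≡1+∣p∣ {x = Fin.suc x} (outside ∷ p) x∉p = x∉p⇒∣p∪⁅x⁆∣≡1+∣p∣ p (x∉p ∘ there)

∣p─q∣+∣p∩q∣≡∣p∣ : ∀ (p q : Subset n) → ∣ p ─ q ∣ + ∣ p ∩ q ∣ ≡ ∣ p ∣
∣p─q∣+∣p∩q∣≡∣p∣ []            []            = refl
∣p─q∣+∣p∩q∣≡∣p∣ (inside ∷ p)  (inside ∷ q)  = trans (+-suc _ _) (cong suc (∣p─q∣+∣p∩q∣≡∣p∣ p q))
∣p─q∣+∣p∩q∣≡∣p∣ (inside ∷ p)  (outside ∷ q) = cong suc (∣p─q∣+∣p∩q∣≡∣p∣ p q)
∣p─q∣+∣p∩q∣≡∣p∣ (outside ∷ p) (inside ∷ q)  = ∣p─q∣+∣p∩q∣≡∣p∣ p q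
∣p─q∣+∣p∩q∣≡∣p∣ (outside ∷ p) (outside ∷ q) = ∣p─q∣+∣p∩q∣≡∣p∣ p q

q⊆p⇒∣p─q∣≤k : q ⊆ p → ∣ p ∣ ∸ k ≤ ∣ q ∣ → ∣ p ─ q ∣ ≤ k
q⊆p⇒∣p─q∣≤k {q = q} {p = p} {k = k} q⊆p ∣p∣∸k≤∣q∣ = +-cancelʳ-≤ ∣ p ∩ q ∣ ∣ p ─ q ∣ k (begin
  ∣ p ─ q ∣ + ∣ p ∩ q ∣  ≡⟨ ∣p─q∣+∣p∩q∣≡∣p∣ p q ⟩
  ∣ p ∣                  ≤⟨ m≤n+m∸n ∣ p ∣ k ⟩
  k + (∣ p ∣ ∸ k)        ≤⟨ +-monoʳ-≤ k (≤-trans ∣p∣∸k≤∣q∣ ∣q∣≤∣p∩q∣) ⟩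
  k + ∣ p ∩ q ∣          ∎)
  where
  open ≤-Reasoning
  ∣q∣≤∣p∩q∣ : ∣ q ∣ ≤ ∣ p ∩ q ∣
  ∣q∣≤∣p∩q∣ = p⊆q⇒∣p∣≤∣q∣ (λ x∈q → x∈p∩q⁺ (q⊆p x∈q , x∈q))

Facet⊇ : SimplicialComplex n → Subset n → Set
Facet⊇ {n} C p = Σ (Subset n) λ F → IsFacet C F × p ⊆ F

module _ (C : SimplicialComplex n) where

  Adj-sym : Adj C x y → Adj C y x
  Adj-sym (x≢y , xy-face) = ≢-sym x≢y , down-closed C xy-face (∪-lub (q⊆p∪q _ _) (p⊆p∪q _))

  ∈-face⇒IsVertex : Face C p → x ∈ p → IsVertex C x
  ∈-face⇒IsVertex p-face x∈p = down-closed C p-face (x∈p⇒⁅x⁆⊆p x∈p)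

  ∈-face⇒Adj : Face C p → x ∈ p → y ∈ p → x ≢ y → Adj C x y
  ∈-face⇒Adj p-face x∈p y∈p x≢y = x≢y , down-closed C p-face (∪-lub (x∈p⇒⁅x⁆⊆p x∈p) (x∈p⇒⁅x⁆⊆p y∈p))

  ∈-clique⇒pair-face : IsClique C p → x ∈ p → y ∈ p → Face C (⁅ x ⁆ ∪ ⁅ y ⁆)
  ∈-clique⇒pair-face {x = x} {y = y} (vertex , adj) x∈p y∈p with x ≟ y
  ... | yes refl = down-closed C (vertex x∈p) (∪-lub ⊆-refl ⊆-refl)
  ... | no x≢y = let (_ , xy-face) = adj x∈p y∈p x≢y in xy-face

  ⊆-clique⇒face : IsClique C q → Nonempty q → p ⊆ q → ∣ p ∣ ≤ 2 → Face C p
  ⊆-clique⇒face q-clique q-nonempty p⊆q ∣p∣≤2 =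
    let (x , y , x∈q , y∈q , p⊆xy) = ∣p∣≤2⇒⊆pair q-nonempty p⊆q ∣p∣≤2
    in down-closed C (∈-clique⇒pair-face q-clique x∈q y∈q) p⊆xy

  clique∪⁅x⁆ : IsClique C p → IsVertex C x → (∀ {u} → u ∈ p → u ≢ x → Adj C u x) → IsClique C (p ∪ ⁅ x ⁆)
  clique∪⁅x⁆ {p = p} {x = x} (vertex , adj) x-vertex x-adj = vertex′ , adj′
    where
    vertex′ : ∀ {v} → v ∈ p ∪ ⁅ x ⁆ → IsVertex C v
    vertex′ v∈p∪x with x∈p∪q⁻ p ⁅ x ⁆ v∈p∪x
    ... | inj₁ v∈p = vertex v∈p
    ... | inj₂ v∈⁅x⁆ rewrite x∈⁅y⁆⇒x≡y x v∈⁅x⁆ = x-vertex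
    adj′ : ∀ {u v} → u ∈ p ∪ ⁅ x ⁆ → v ∈ p ∪ ⁅ x ⁆ → u ≢ v → Adj C u v
    adj′ u∈p∪x v∈p∪x u≢v with x∈p∪q⁻ p ⁅ x ⁆ u∈p∪x | x∈p∪q⁻ p ⁅ x ⁆ v∈p∪x
    ... | inj₁ u∈p  | inj₁ v∈p  = adj u∈p v∈p u≢v
    ... | inj₁ u∈p  | inj₂ v∈⁅x⁆ rewrite x∈⁅y⁆⇒x≡y x v∈⁅x⁆ = x-adj u∈p u≢v
    ... | inj₂ u∈⁅x⁆ | inj₁ v∈p  rewrite x∈⁅y⁆⇒x≡y x u∈⁅x⁆ = Adj-sym (x-adj v∈p (≢-sym u≢v))
    ... | inj₂ u∈⁅x⁆ | inj₂ v∈⁅x⁆ = contradiction (trans (x∈⁅y⁆⇒x≡y x u∈⁅x⁆) (sym (x∈⁅y⁆⇒x≡y x v∈⁅x⁆))) u≢v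

  maximal-face⇒IsFacet : Face C p → (∀ x → x ∉ p → ¬ Face C (p ∪ ⁅ x ⁆)) → IsFacet C p
  maximal-face⇒IsFacet {p = p} p-face maximal = p-face , λ q q-face p⊆q {x} x∈q →
    decidable-stable (x ∈? p) λ x∉p → maximal x x∉p (down-closed C q-face (∪-lub p⊆q (x∈p⇒⁅x⁆⊆p x∈q)))

  face⇒facet⊇ : Face C p → Facet⊇ C p
  face⇒facet⊇ {p = p} = grow n (m≤m+n n ∣ p ∣)
    where
    grow : ∀ {p} m → n ≤ m + ∣ p ∣ → Face C p → Facet⊇ C p
    grow {p} m n≤m+∣p∣ p-face with any? (λ x → ¬? (x ∈? p) ×-dec face? C (p ∪ ⁅ x ⁆))
    ... | no ¬growable = p , maximal-face⇒IsFacet p-face (λ x x∉p px-face → ¬growable (x , x∉p , px-face)) , ⊆-refl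
    ... | yes (x , x∉p , px-face) with m
    ...   | zero = contradiction (subst (_≤ n) ∣p∪⁅x⁆∣≡1+∣p∣ (∣p∣≤n (p ∪ ⁅ x ⁆))) (≤⇒≯ n≤m+∣p∣)
      where
      ∣p∪⁅x⁆∣≡1+∣p∣ : ∣ p ∪ ⁅ x ⁆ ∣ ≡ suc ∣ p ∣
      ∣p∪⁅x⁆∣≡1+∣p∣ = x∉p⇒∣p∪⁅x⁆∣≡1+∣p∣ p x∉p
    ...   | suc m = let (F , F-facet , px⊆F) = grow m n≤m+∣px∣ px-face in F , F-facet , ⊆-trans (p⊆p∪q _) px⊆F
      where
      n≤m+∣px∣ : n ≤ m + ∣ p ∪ ⁅ x ⁆ ∣
      n≤m+∣px∣ = ≤-trans n≤m+∣p∣ (≤-reflexive (trans (sym (+-suc m ∣ p ∣)) (cong (m +_) (sym (x∉p⇒∣p∪⁅x⁆∣≡1+∣p∣ p x∉p)))))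

  x∉K⇒IsFacet[K∪⁅x⁆] : (∀ F → IsKClique C (suc d) F → IsFacet C F) → IsKClique C d K → x ∉ K → IsVertex C x
                      → (∀ {u} → u ∈ K → u ≢ x → Adj C u x) → IsFacet C (K ∪ ⁅ x ⁆)
  x∉K⇒IsFacet[K∪⁅x⁆] {K = K} {x = x} clique⇒facet (K-clique , ∣K∣≡d) x∉K x-vertex x-adj =
    clique⇒facet (K ∪ ⁅ x ⁆) (clique∪⁅x⁆ K-clique x-vertex x-adj , trans (x∉p⇒∣p∪⁅x⁆∣≡1+∣p∣ K x∉K) (cong suc ∣K∣≡d))

  h∈H─K⇒facet⊇K : FullyConed C d H → IsKClique C d K → x ∈ H → x ∉ K → Facet⊇ C K
  h∈H─K⇒facet⊇K {K = K} {x = h} (H-vertex , H-adj , clique⇒facet) K-dclique@((K-vertex , _) , _) h∈H h∉K =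
    K ∪ ⁅ h ⁆ , x∉K⇒IsFacet[K∪⁅x⁆] clique⇒facet K-dclique h∉K (H-vertex h∈H) h-adj , p⊆p∪q _
    where
    h-adj : ∀ {u} → u ∈ K → u ≢ h → Adj C u h
    h-adj u∈K u≢h = Adj-sym (H-adj h∈H (K-vertex u∈K) u≢h)

  ∣K─H∣≤2⇒facet⊇K : PureDim C d → FullyConed C d H → IsKClique C d K → Nonempty K → ∣ K ─ H ∣ ≤ 2 → Facet⊇ C K
  ∣K─H∣≤2⇒facet⊇K {H = H} {K = K} pure (_ , H-adj , clique⇒facet) K-dclique@(K-clique , ∣K∣≡d) K-nonempty ∣K─H∣≤2
    with face⇒facet⊇ (⊆-clique⇒face K-clique K-nonempty (p─q⊆p K H) ∣K─H∣≤2)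
  ... | F , F-facet@(F-face , _) , K─H⊆F with ∣p∣<∣q∣⇒∃∈∉ (≤-reflexive (trans (cong suc ∣K∣≡d) (sym (pure F F-facet))))
  ... | w , w∈F , w∉K = K ∪ ⁅ w ⁆ , x∉K⇒IsFacet[K∪⁅x⁆] clique⇒facet K-dclique w∉K w-vertex w-adj , p⊆p∪q _
    where
    w-vertex : IsVertex C w
    w-vertex = ∈-face⇒IsVertex F-face w∈F
    w-adj : ∀ {u} → u ∈ K → u ≢ w → Adj C u w
    w-adj {u} u∈K u≢w with u ∈? H
    ... | yes u∈H = H-adj u∈H w-vertex (≢-sym u≢w)
    ... | no u∉H = ∈-face⇒Adj F-face (K─H⊆F (x∈p∧x∉q⇒x∈p─q u∈K u∉H)) w∈F u≢w

lemma4p2 : (n d : ℕ) → 2 ≤ d → (C : SimplicialComplex n) → PureDim C d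
    → (H : Subset n) → FullyConed C d H → d ∸ 2 ≤ ∣ H ∣
    → ∀ K → IsKClique C d K → Σ (Subset n) (λ F → IsFacet C F × K ⊆ F)
lemma4p2 n d 2≤d C pure H coned d∸2≤∣H∣ K K-dclique@(_ , ∣K∣≡d) with ⊆⊎∃∈∉ H K
... | inj₂ (h , h∈H , h∉K) = h∈H─K⇒facet⊇K C coned K-dclique h∈H h∉K
... | inj₁ H⊆K = ∣K─H∣≤2⇒facet⊇K C pure coned K-dclique K-nonempty ∣K─H∣≤2
  where
  K-nonempty : Nonempty K
  K-nonempty = 0<∣p∣⇒Nonempty (subst (0 <_) (sym ∣K∣≡d) (≤-trans (s≤s z≤n) 2≤d))
  ∣K─H∣≤2 : ∣ K ─ H ∣ ≤ 2
  ∣K─H∣≤2 = q⊆p⇒∣p─q∣≤k H⊆K (subst (λ m → m ∸ 2 ≤ ∣ H ∣) (sym ∣K∣≡d) d∸2≤∣H∣)
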